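{- Let $G$ be a finite group, let $M$ be a subgroup of $G$, and let $K$ be a normal subgroup of $G$ contained in $M$. Suppose that $G$ is a split extension of $K$ by $G/K$ (i.e. $K$ has a complement in $G$). Then $M$ is a perfect code of $G$ if and only if $M/K$ is a perfect code of $G/K$.
   Context: A perfect code in a simple undirected graph with vertex set $V$ is an independent subset $C\subseteq V$ such that every vertex in $V\setminus C$ is adjacent to exactly one vertex of $C$. For a group $G$ with identity $e$ and an inverse-closed $S\subseteq G\setminus\{e\}$, the Cayley graph $\mathrm{Cay}(G,S)$ has vertex set $G$ and edges $\{g,sg\}$ ($s\in S$, $g\in G$). A subset $C$ of $G$ is a perfect code of $G$ if it is a perfect code in some Cayley graph $\mathrm{Cay}(G,S)$. -}

module Defs where

open import Level using (Level; _⊔_; suc)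
open import Algebra.Bundles using (Group)
open import Algebra.Bundles.Raw using (RawGroup)
open import Data.Product using (Σ; ∃; _×_; Σ-syntax)
open import Data.List using (List)
open import Data.List.Relation.Unary.Any using (Any)
open import Relation.Nullary using (¬_)

private
  variable
    c ℓ p q s : Level

module _ (R : RawGroup c ℓ) where
  open RawGroup R

  Respects≈ : (Carrier → Set p) → Set (c ⊔ ℓ ⊔ p)
  Respects≈ A = ∀ {x y} → x ≈ y → A x → A y

  CayAdj : (Carrier → Set s) → Carrier → Carrier → Set s
  CayAdj S g h = S (h ∙ g ⁻¹)

  IsConnectionSet : (Carrier → Set s) → Set (c ⊔ ℓ ⊔ s)
  IsConnectionSet S =
    Respects≈ S × (∀ x → S x → S (x ⁻¹)) × (∀ x → S x → ¬ (x ≈ ε))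

  IsPerfectCodeIn : (Carrier → Set s) → (Carrier → Set p) → Set (c ⊔ ℓ ⊔ s ⊔ p)
  IsPerfectCodeIn S C =
    (∀ x y → C x → C y → ¬ CayAdj S x y)
    × (∀ v → ¬ C v →
         (Σ[ x ∈ Carrier ] (C x × CayAdj S v x))
         × (∀ x y → C x → C y → CayAdj S v x → CayAdj S v y → x ≈ y))

  IsPerfectCode : (s : Level) → (Carrier → Set p) → Set (c ⊔ ℓ ⊔ p ⊔ suc s)
  IsPerfectCode s C =
    Σ[ S ∈ (Carrier → Set s) ] (IsConnectionSet S × IsPerfectCodeIn S C)

module _ (G : Group c ℓ) where
  open Group G

  record IsSubgroup (H : Carrier → Set p) : Set (c ⊔ ℓ ⊔ p) where
    field
      resp   : ∀ {x y} → x ≈ y → H x → H y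
      ε∈     : H ε
      ∙-closed : ∀ {x y} → H x → H y → H (x ∙ y)
      ⁻¹-closed : ∀ {x} → H x → H (x ⁻¹)

  record IsNormalSubgroup (K : Carrier → Set p) : Set (c ⊔ ℓ ⊔ p) where
    field
      isSubgroup : IsSubgroup K
      conj-closed : ∀ g {k} → K k → K (g ∙ k ∙ g ⁻¹)

  IsComplement : (K : Carrier → Set p) → (H : Carrier → Set q) → Set (c ⊔ ℓ ⊔ p ⊔ q)
  IsComplement K H =
    IsSubgroup H
    × (∀ x → K x → H x → x ≈ ε)
    × (∀ g → Σ[ k ∈ Carrier ] Σ[ h ∈ Carrier ] (K k × H h × g ≈ k ∙ h))

  SplitsOver : (q : Level) → (K : Carrier → Set p) → Set (c ⊔ ℓ ⊔ p ⊔ suc q)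
  SplitsOver q K = Σ[ H ∈ (Carrier → Set q) ] IsComplement K H

  IsFinite : Set (c ⊔ ℓ)
  IsFinite = Σ[ xs ∈ List Carrier ] (∀ g → Any (g ≈_) xs)

  -- The quotient group G/K: same carrier, x ≡ y (mod K) iff x⁻¹ y ∈ K,
  -- with the induced operations (well defined when K is normal).
  quotientGroup : (K : Carrier → Set p) → RawGroup c p
  quotientGroup K = record
    { Carrier = Carrier
    ; _≈_ = λ x y → K (x ⁻¹ ∙ y)
    ; _∙_ = _∙_
    ; ε = ε
    ; _⁻¹ = _⁻¹
    }

  imageMod : (M : Carrier → Set p) → (K : Carrier → Set q) → Carrier → Set (c ⊔ p ⊔ q)
  imageMod M K y = Σ[ x ∈ Carrier ] (M x × K (x ⁻¹ ∙ y))

-- If S is a connection set for M in G, its K-saturation, read in G/K, is one for M/K: M is a union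
-- of K-cosets, so adjacency to M descends to G/K. Conversely, if T is a connection set for M/K and H
-- is a complement of K, then T ∩ H is one for M: each coset of K meets H exactly once, so the unique
-- neighbour of v in M/K yields exactly one neighbour h v of v in M with h ∈ T ∩ H.
module Submission where

open import Defs
open import Level using (Level; _⊔_)
open import Algebra.Bundles using (Group)
open import Algebra.Bundles.Raw using (RawGroup)
open import Function.Base using (_∘_)
open import Function.Bundles using (_⇔_; mk⇔)
open import Data.Product using (_×_; _,_; Σ-syntax)
open import Relation.Nullary using (¬_)
import Algebra.Properties.Group as GroupProperties
import Relation.Binary.Reasoning.Setoid as SetoidReasoning

private
  variable
    c ℓ k m s : Level

module CosetCongruence (G : Group c ℓ) {K : Group.Carrier G → Set k}
                       (K-normal : IsNormalSubgroup G K) where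
  open Group G
  open GroupProperties G
  open SetoidReasoning setoid
  open IsNormalSubgroup K-normal using (isSubgroup; conj-closed)
  open IsSubgroup isSubgroup

  _~_ : Carrier → Carrier → Set k
  x ~ y = RawGroup._≈_ (quotientGroup G K) x y

  ≈⇒~ : ∀ {x y} → x ≈ y → x ~ y
  ≈⇒~ {x} x≈y = resp (trans (sym (inverseˡ x)) (∙-congˡ x≈y)) ε∈

  ~-refl : ∀ {x} → x ~ x
  ~-refl = ≈⇒~ refl

  ~-sym : ∀ {x y} → x ~ y → y ~ x
  ~-sym {x} {y} x~y = resp (⁻¹-anti-homo-\\ x y) (⁻¹-closed x~y)

  ~-trans : ∀ {x y z} → x ~ y → y ~ z → x ~ z
  ~-trans {x} {y} {z} x~y y~z = resp eq (∙-closed x~y y~z)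
    where
    eq : (x ⁻¹ ∙ y) ∙ (y ⁻¹ ∙ z) ≈ x ⁻¹ ∙ z
    eq = trans (assoc _ _ _) (∙-congˡ (\\-leftDividesˡ y z))

  ε~⇒∈ : ∀ {x} → ε ~ x → K x
  ε~⇒∈ {x} = resp (trans (∙-congʳ ε⁻¹≈ε) (identityˡ x))

  ∈⇒~∙ : ∀ {a} x → K a → x ~ (a ∙ x)
  ∈⇒~∙ {a} x a∈K = resp eq (conj-closed (x ⁻¹) a∈K)
    where
    eq : x ⁻¹ ∙ a ∙ x ⁻¹ ⁻¹ ≈ x ⁻¹ ∙ (a ∙ x)
    eq = trans (∙-congˡ (⁻¹-involutive x)) (assoc _ _ _)

  ∙-congʳ-~ : ∀ {x y} g → x ~ y → (x ∙ g) ~ (y ∙ g)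
  ∙-congʳ-~ {x} {y} g x~y = resp eq (conj-closed (g ⁻¹) x~y)
    where
    eq : g ⁻¹ ∙ (x ⁻¹ ∙ y) ∙ g ⁻¹ ⁻¹ ≈ (x ∙ g) ⁻¹ ∙ (y ∙ g)
    eq = begin
      g ⁻¹ ∙ (x ⁻¹ ∙ y) ∙ g ⁻¹ ⁻¹  ≈⟨ ∙-cong (sym (assoc _ _ _)) (⁻¹-involutive g) ⟩
      g ⁻¹ ∙ x ⁻¹ ∙ y ∙ g           ≈⟨ assoc _ _ _ ⟩
      g ⁻¹ ∙ x ⁻¹ ∙ (y ∙ g)         ≈⟨ ∙-congʳ (⁻¹-anti-homo-∙ x g) ⟨
      (x ∙ g) ⁻¹ ∙ (y ∙ g)          ∎

  ⁻¹-cong-~ : ∀ {x y} → x ~ y → (x ⁻¹) ~ (y ⁻¹)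
  ⁻¹-cong-~ {x} {y} x~y = resp eq (⁻¹-closed (conj-closed x x~y))
    where
    eq : (x ∙ (x ⁻¹ ∙ y) ∙ x ⁻¹) ⁻¹ ≈ x ⁻¹ ⁻¹ ∙ y ⁻¹
    eq = begin
      (x ∙ (x ⁻¹ ∙ y) ∙ x ⁻¹) ⁻¹  ≈⟨ ⁻¹-cong (∙-congʳ (\\-leftDividesˡ x y)) ⟩
      (y ∙ x ⁻¹) ⁻¹               ≈⟨ ⁻¹-anti-homo-∙ y (x ⁻¹) ⟩
      x ⁻¹ ⁻¹ ∙ y ⁻¹              ∎

  //~⇒~∙ : ∀ {x y} v → (x ∙ v ⁻¹) ~ y → x ~ (y ∙ v)
  //~⇒~∙ {x} v xv⁻¹~y = ~-trans (≈⇒~ (sym (//-rightDividesˡ v x))) (∙-congʳ-~ v xv⁻¹~y)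

module _ (G : Group c ℓ) where
  open Group G
  open GroupProperties G

  independent∋ε⇒disjoint : ∀ {C : Carrier → Set m} {S : Carrier → Set s} →
    Respects≈ rawGroup S → (∀ x y → C x → C y → ¬ CayAdj rawGroup S x y) →
    C ε → ∀ {x} → C x → ¬ S x
  independent∋ε⇒disjoint S-resp C-indep ε∈C {x} x∈C x∈S =
    C-indep ε x ε∈C x∈C (S-resp (sym (trans (∙-congˡ ε⁻¹≈ε) (identityʳ x))) x∈S)

module _ (G : Group c ℓ) {M : Group.Carrier G → Set m} {K : Group.Carrier G → Set k}
         (M-subgroup : IsSubgroup G M) (K-normal : IsNormalSubgroup G K)
         (K⊆M : ∀ x → K x → M x) where
  open Group G
  open GroupProperties G
  open CosetCongruence G K-normal
  module M = IsSubgroup M-subgroup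

  private
    G/K : RawGroup c k
    G/K = quotientGroup G K

    M/K : Carrier → Set (c ⊔ m ⊔ k)
    M/K = imageMod G M K

  ∈-resp-~ : ∀ {x y} → x ~ y → M x → M y
  ∈-resp-~ {x} {y} x~y x∈M = M.resp (\\-leftDividesˡ x y) (M.∙-closed x∈M (K⊆M _ x~y))

  ∈image⇒∈ : ∀ {y} → M/K y → M y
  ∈image⇒∈ (x , x∈M , x~y) = ∈-resp-~ x~y x∈M

  ∈⇒∈image : ∀ {y} → M y → M/K y
  ∈⇒∈image {y} y∈M = y , y∈M , ~-refl

  perfectCode⇒quotientPerfectCode : ∀ {s} →
    IsPerfectCode rawGroup s M → IsPerfectCode G/K (c ⊔ k ⊔ s) M/K
  perfectCode⇒quotientPerfectCode {s} (S , (S-resp , S-inv , _) , (M-indep , M-cover)) =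
    SK , (SK-resp , SK-inv , SK-ε∉) , (M/K-indep , M/K-cover)
    where
    SK : Carrier → Set (c ⊔ k ⊔ s)
    SK x = Σ[ t ∈ Carrier ] (S t × x ~ t)

    S∩M=∅ : ∀ {t} → M t → ¬ S t
    S∩M=∅ = independent∋ε⇒disjoint G S-resp M-indep M.ε∈

    SK-resp : Respects≈ G/K SK
    SK-resp x~y (t , t∈S , x~t) = t , t∈S , ~-trans (~-sym x~y) x~t

    SK-inv : ∀ x → SK x → SK (x ⁻¹)
    SK-inv x (t , t∈S , x~t) = t ⁻¹ , S-inv t t∈S , ⁻¹-cong-~ x~t

    SK-ε∉ : ∀ x → SK x → ¬ (x ~ ε)
    SK-ε∉ x (t , t∈S , x~t) x~ε = S∩M=∅ (K⊆M t (ε~⇒∈ (~-trans (~-sym x~ε) x~t))) t∈S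

    M/K-indep : ∀ x y → M/K x → M/K y → ¬ CayAdj G/K SK x y
    M/K-indep x y x∈ y∈ (t , t∈S , yx⁻¹~t) =
      S∩M=∅ (∈-resp-~ yx⁻¹~t (M.∙-closed (∈image⇒∈ y∈) (M.⁻¹-closed (∈image⇒∈ x∈)))) t∈S

    lift-neighbour : ∀ {a v} → M a → CayAdj G/K SK v a →
      Σ[ x ∈ Carrier ] (a ~ x × M x × CayAdj rawGroup S v x)
    lift-neighbour {a} {v} a∈M (t , t∈S , av⁻¹~t) =
      t ∙ v , a~tv , ∈-resp-~ a~tv a∈M , S-resp (sym (//-rightDividesʳ v t)) t∈S
      where
      a~tv : a ~ (t ∙ v)
      a~tv = //~⇒~∙ v av⁻¹~t

    M/K-cover : ∀ v → ¬ M/K v →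
      (Σ[ x ∈ Carrier ] (M/K x × CayAdj G/K SK v x))
      × (∀ x y → M/K x → M/K y → CayAdj G/K SK v x → CayAdj G/K SK v y → x ~ y)
    M/K-cover v v∉ with M-cover v (v∉ ∘ ∈⇒∈image)
    ... | (x , x∈M , xv⁻¹∈S) , unique = (x , ∈⇒∈image x∈M , (x ∙ v ⁻¹ , xv⁻¹∈S , ~-refl)) , unique/K
      where
      unique/K : ∀ a b → M/K a → M/K b → CayAdj G/K SK v a → CayAdj G/K SK v b → a ~ b
      unique/K a b a∈ b∈ va∈SK vb∈SK
        with lift-neighbour (∈image⇒∈ a∈) va∈SK | lift-neighbour (∈image⇒∈ b∈) vb∈SK
      ... | a′ , a~a′ , a′∈M , va′∈S | b′ , b~b′ , b′∈M , vb′∈S =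
        ~-trans a~a′ (~-trans (≈⇒~ (unique a′ b′ a′∈M b′∈M va′∈S vb′∈S)) (~-sym b~b′))

  quotientPerfectCode⇒perfectCode : ∀ {q s} → SplitsOver G q K →
    IsPerfectCode G/K s M/K → IsPerfectCode rawGroup (s ⊔ q) M
  quotientPerfectCode⇒perfectCode {q} {s} (H , H-subgroup , K∩H=1 , K∙H=G)
    (T , (T-resp , T-inv , T-ε∉) , (M/K-indep , M/K-cover)) =
    T∩H , (T∩H-resp , T∩H-inv , T∩H-ε∉) , (M-indep , M-cover)
    where
    module H = IsSubgroup H-subgroup

    T∩H : Carrier → Set (s ⊔ q)
    T∩H x = T x × H x

    T∩H-resp : Respects≈ rawGroup T∩H
    T∩H-resp x≈y (x∈T , x∈H) = T-resp (≈⇒~ x≈y) x∈T , H.resp x≈y x∈H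

    T∩H-inv : ∀ x → T∩H x → T∩H (x ⁻¹)
    T∩H-inv x (x∈T , x∈H) = T-inv x x∈T , H.⁻¹-closed x∈H

    T∩H-ε∉ : ∀ x → T∩H x → ¬ (x ≈ ε)
    T∩H-ε∉ x (x∈T , _) x≈ε = T-ε∉ x x∈T (≈⇒~ x≈ε)

    M-indep : ∀ x y → M x → M y → ¬ CayAdj rawGroup T∩H x y
    M-indep x y x∈M y∈M (yx⁻¹∈T , _) = M/K-indep x y (∈⇒∈image x∈M) (∈⇒∈image y∈M) yx⁻¹∈T

    ~∩H⇒≈ : ∀ {x y} → x ~ y → H x → H y → x ≈ y
    ~∩H⇒≈ x~y x∈H y∈H =
      ⁻¹-injective (inverseˡ-unique _ _ (K∩H=1 _ x~y (H.∙-closed (H.⁻¹-closed x∈H) y∈H)))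

    M-cover : ∀ v → ¬ M v →
      (Σ[ x ∈ Carrier ] (M x × CayAdj rawGroup T∩H v x))
      × (∀ x y → M x → M y → CayAdj rawGroup T∩H v x → CayAdj rawGroup T∩H v y → x ≈ y)
    M-cover v v∉M with M/K-cover v (v∉M ∘ ∈image⇒∈)
    ... | (x , x∈ , xv⁻¹∈T) , unique/K with K∙H=G (x ∙ v ⁻¹)
    ...   | a , h , a∈K , h∈H , xv⁻¹≈ah = (h ∙ v , hv∈M , hvv⁻¹∈T∩H) , unique
      where
      h~xv⁻¹ : h ~ (x ∙ v ⁻¹)
      h~xv⁻¹ = ~-trans (∈⇒~∙ h a∈K) (≈⇒~ (sym xv⁻¹≈ah))

      hv∈M : M (h ∙ v)
      hv∈M = ∈-resp-~ (//~⇒~∙ v (~-sym h~xv⁻¹)) (∈image⇒∈ x∈)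

      hvv⁻¹∈T∩H : T∩H (h ∙ v ∙ v ⁻¹)
      hvv⁻¹∈T∩H = T∩H-resp (sym (//-rightDividesʳ v h)) (T-resp (~-sym h~xv⁻¹) xv⁻¹∈T , h∈H)

      unique : ∀ b b′ → M b → M b′ → CayAdj rawGroup T∩H v b → CayAdj rawGroup T∩H v b′ → b ≈ b′
      unique b b′ b∈M b′∈M (bv⁻¹∈T , bv⁻¹∈H) (b′v⁻¹∈T , b′v⁻¹∈H) =
        ∙-cancelʳ (v ⁻¹) b b′ (~∩H⇒≈ (∙-congʳ-~ (v ⁻¹) b~b′) bv⁻¹∈H b′v⁻¹∈H)
        where
        b~b′ : b ~ b′
        b~b′ = unique/K b b′ (∈⇒∈image b∈M) (∈⇒∈image b′∈M) bv⁻¹∈T b′v⁻¹∈T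

theorem4p4 : ∀ {c ℓ p} (G : Group c ℓ) → IsFinite G →
    (M K : Group.Carrier G → Set p) →
    IsSubgroup G M → IsNormalSubgroup G K → (∀ x → K x → M x) →
    SplitsOver G p K →
    (IsPerfectCode (Group.rawGroup G) (c ⊔ ℓ ⊔ p) M ⇔ IsPerfectCode (quotientGroup G K) (c ⊔ ℓ ⊔ p) (imageMod G M K))
theorem4p4 G _ M K M-subgroup K-normal K⊆M splits =
  mk⇔ (perfectCode⇒quotientPerfectCode G M-subgroup K-normal K⊆M)
      (quotientPerfectCode⇒perfectCode G M-subgroup K-normal K⊆M splits)
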